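{- Let $\mathbb{F}_q$ be a finite field with $q=2p+1$ where $p$ is an odd prime. Let $\gamma\in\mathbb{F}_q^\times$ with $\gamma\neq1$ and $\gamma\neq-1$, and let $a=\gamma-\gamma^{ -1}$. Then $x^2-ax-1$ (the characteristic polynomial of $Q=\begin{pmatrix} a & 1\\ 1 & 0\end{pmatrix}$) has exactly one Lucas primitive root.
   Context: A Lucas primitive root is a root of $x^2-ax-1$ in $\mathbb{F}_q$ that generates the cyclic group $\mathbb{F}_q^\times$. Here $p$ denotes a prime with $q=2p+1$ (not necessarily the characteristic). -}

module Defs where

open import Level using (Level; _⊔_) renaming (suc to lsuc)
open import Algebra.Bundles using (CommutativeRing; Semiring)
open import Data.Nat using (ℕ)
open import Data.Fin using (Fin)
open import Data.Product using (∃; _×_)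
open import Relation.Nullary using (¬_)
open import Relation.Binary.PropositionalEquality using (_≡_)

-- A finite field: a commutative ring (with setoid equality _≈_) in which
-- 0 ≠ 1 and every nonzero element has a multiplicative inverse, together
-- with an enumeration Fin size → Carrier that is a bijection up to _≈_.
-- "size" is the order q of the field.
record FiniteField (c ℓ : Level) : Set (lsuc (c ⊔ ℓ)) where
  field
    commRing : CommutativeRing c ℓ
  open CommutativeRing commRing public
  field
    0≉1       : ¬ (0# ≈ 1#)
    inverse   : ∀ x → ¬ (x ≈ 0#) → ∃ λ y → x * y ≈ 1#
    size      : ℕ
    enum      : Fin size → Carrier
    enum-surj : ∀ x → ∃ λ i → x ≈ enum i
    enum-inj  : ∀ i j → enum i ≈ enum j → i ≡ j

module _ {c ℓ : Level} (F : FiniteField c ℓ) where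
  open FiniteField F
  open import Algebra.Definitions.RawSemiring (Semiring.rawSemiring semiring) using (_^_)

  IsPrimitiveRoot : Carrier → Set (c ⊔ ℓ)
  IsPrimitiveRoot g = ¬ (g ≈ 0#) × (∀ x → ¬ (x ≈ 0#) → ∃ λ (k : ℕ) → x ≈ g ^ k)

  IsRootOfLucasPoly : Carrier → Carrier → Set ℓ
  IsRootOfLucasPoly a r = r * r - a * r - 1# ≈ 0#

  IsLucasPrimitiveRoot : Carrier → Carrier → Set (c ⊔ ℓ)
  IsLucasPrimitiveRoot a r = IsRootOfLucasPoly a r × IsPrimitiveRoot r

  HasExactlyOneLucasPrimitiveRoot : Carrier → Set (c ⊔ ℓ)
  HasExactlyOneLucasPrimitiveRoot a =
    ∃ λ r → IsLucasPrimitiveRoot a r × (∀ s → IsLucasPrimitiveRoot a s → s ≈ r)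

-- Every unit r of F_q satisfies r^(q−1) = r^(2p) = 1, so r^p = ±1, and r has order 2p (hence
-- generates F_q^×) exactly when r^p = −1 and r² ≠ 1.  For a = γ − γ⁻¹ the roots of x² − a x − 1
-- are γ and −γ⁻¹; their product is −1, so γ^p·(−γ⁻¹)^p = (−1)^p = −1 since p is odd, and exactly
-- one of the two p-th powers is −1 (as −1 ≠ 1 in odd characteristic).  Neither root squares to 1
-- because γ ≠ ±1, so exactly that root is primitive.
module Submission where

open import Defs
open import Level using (Level)
open import Algebra.Bundles using (Semiring)
open import Data.Nat as ℕ using (ℕ; zero; suc; _∸_; z≤n; s≤s; NonZero)
open import Data.Nat.Properties as ℕ using ()
open import Algebra.Properties.CommutativeSemigroup ℕ.*-commutativeSemigroup using (xy∙z≈xz∙y)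
open import Data.Nat.DivMod using (_%_; _/_; m≡m%n+[m/n]*n; m%n<n)
open import Data.Nat.Divisibility using (_∣_; divides; ∣⇒≤; n∣m*n; m%n≡0⇒n∣m)
open import Data.Nat.GCD using (gcd; gcd-GCD; gcd[m,n]∣m; gcd[m,n]∣n; module Bézout)
open import Data.Nat.Primality using (Prime; euclidsLemma; prime⇒nonZero)
open import Data.Fin as Fin using (Fin; zero; suc; toℕ; fromℕ<; punchIn; punchOut)
open import Data.Fin.Properties as Fin using ()
open import Data.Fin.Permutation using (Permutation′; permutation; _⟨$⟩ʳ_)
open import Data.Product using (∃; _×_; _,_; proj₁; proj₂)
open import Data.Sum using (_⊎_; inj₁; inj₂; swap)
open import Function using (_∘_)
open import Relation.Binary.Definitions using (tri<; tri≈; tri>)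
open import Relation.Nullary using (¬_; Dec; yes; no; contradiction)
open import Relation.Binary.PropositionalEquality as ≡ using (_≡_; _≢_)
import Algebra.Properties.CommutativeMonoid.Sum
import Algebra.Solver.CommutativeMonoid

%2≡1 : ∀ n → ¬ (2 ∣ n) → n % 2 ≡ 1
%2≡1 n 2∤n with n % 2 | m%n<n n 2 | m%n≡0⇒n∣m n 2
... | 0           | _             | 2∣n = contradiction (2∣n ≡.refl) 2∤n
... | 1           | _             | _   = ≡.refl
... | suc (suc _) | s≤s (s≤s ()) | _

∣2*p⇒∣2⊎≡p : ∀ {p d} → Prime p → d ∣ 2 ℕ.* p → d ℕ.< 2 ℕ.* p → d ∣ 2 ⊎ d ≡ p
∣2*p⇒∣2⊎≡p {p} {d} p-prime (divides e 2p≡e*d) d<2p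
  with euclidsLemma e d p-prime (divides 2 (≡.sym 2p≡e*d))
... | inj₁ (divides g e≡g*p) = inj₁ (divides g (ℕ.*-cancelʳ-≡ 2 (g ℕ.* d) p 2p≡gd*p))
  where
  instance p≢0 : NonZero p
           p≢0 = prime⇒nonZero p-prime
  2p≡gd*p : 2 ℕ.* p ≡ g ℕ.* d ℕ.* p
  2p≡gd*p = ≡.trans 2p≡e*d (≡.trans (≡.cong (ℕ._* d) e≡g*p) (xy∙z≈xz∙y g p d))
... | inj₂ (divides 0 d≡0) =
  contradiction (≡.trans 2p≡e*d (≡.trans (≡.cong (e ℕ.*_) d≡0) (ℕ.*-zeroʳ e))) (ℕ.m<n⇒n≢0 d<2p)
... | inj₂ (divides 1 d≡p) = inj₂ (≡.trans d≡p (ℕ.*-identityˡ p))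
... | inj₂ (divides (suc (suc f)) d≡2p+) =
  contradiction (≡.subst (2 ℕ.* p ℕ.≤_) (≡.sym d≡2p+) (ℕ.*-monoˡ-≤ p (s≤s (s≤s (z≤n {f}))))) (ℕ.<⇒≱ d<2p)

module FieldProperties {c ℓ : Level} (F : FiniteField c ℓ) where
  open FiniteField F hiding (zero)
  open import Algebra.Definitions.RawSemiring (Semiring.rawSemiring semiring) using (_^_)
  open import Algebra.Properties.Ring ring using (-1*x≈-x; -‿distribʳ-*; [y-z]x≈yx-zx)
  open import Algebra.Properties.Semiring.Exp semiring using (^-congˡ; ^-congʳ; ^-homo-*; ^-assocʳ)
  open import Algebra.Properties.CommutativeSemiring.Exp commutativeSemiring using (^-distrib-*)
  open import Algebra.Properties.Group +-group
    using (∙-cancelˡ; ε⁻¹≈ε; ⁻¹-involutive; ⁻¹-injective; inverseˡ-unique; x∙y⁻¹≈ε⇒x≈y; ⁻¹-anti-homo-//)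
  module ∏ = Algebra.Properties.CommutativeMonoid.Sum *-commutativeMonoid
  module ∑ = Algebra.Properties.CommutativeMonoid.Sum +-commutativeMonoid
  open import Algebra.Properties.Monoid.Mult +-monoid using (×-assocˡ; ×-congʳ) renaming (_×_ to _·_)
  open import Relation.Binary.Reasoning.Setoid setoid

  _≟_ : ∀ x y → Dec (x ≈ y)
  x ≟ y with enum-surj x | enum-surj y
  ... | i , x≈eᵢ | j , y≈eⱼ with i Fin.≟ j
  ... | yes ≡.refl = yes (trans x≈eᵢ (sym y≈eⱼ))
  ... | no i≢j     = no λ x≈y → i≢j (enum-inj i j (trans (sym x≈eᵢ) (trans x≈y y≈eⱼ)))

  1≉0 : 1# ≉ 0#
  1≉0 1≈0 = 0≉1 (sym 1≈0)

  -1≉0 : - 1# ≉ 0#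
  -1≉0 -1≈0 = 1≉0 (trans (sym (⁻¹-involutive 1#)) (trans (-‿cong -1≈0) ε⁻¹≈ε))

  *-cancelˡ : ∀ {x y z} → x ≉ 0# → x * y ≈ x * z → y ≈ z
  *-cancelˡ {x} {y} {z} x≉0 xy≈xz with inverse x x≉0
  ... | x⁻¹ , xx⁻¹≈1 = begin
    y              ≈⟨ sym (*-identityˡ y) ⟩
    1# * y         ≈⟨ *-congʳ (trans (sym xx⁻¹≈1) (*-comm x x⁻¹)) ⟩
    (x⁻¹ * x) * y  ≈⟨ *-assoc x⁻¹ x y ⟩
    x⁻¹ * (x * y)  ≈⟨ *-congˡ xy≈xz ⟩
    x⁻¹ * (x * z)  ≈⟨ sym (*-assoc x⁻¹ x z) ⟩
    (x⁻¹ * x) * z  ≈⟨ *-congʳ (trans (*-comm x⁻¹ x) xx⁻¹≈1) ⟩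
    1# * z         ≈⟨ *-identityˡ z ⟩
    z              ∎

  x*y≈0⇒x≈0⊎y≈0 : ∀ {x y} → x * y ≈ 0# → x ≈ 0# ⊎ y ≈ 0#
  x*y≈0⇒x≈0⊎y≈0 {x} {y} xy≈0 with x ≟ 0#
  ... | yes x≈0 = inj₁ x≈0
  ... | no  x≉0 = inj₂ (*-cancelˡ x≉0 (trans xy≈0 (sym (zeroʳ x))))

  *-nonzero : ∀ {x y} → x ≉ 0# → y ≉ 0# → x * y ≉ 0#
  *-nonzero x≉0 y≉0 xy≈0 with x*y≈0⇒x≈0⊎y≈0 xy≈0
  ... | inj₁ x≈0 = x≉0 x≈0
  ... | inj₂ y≈0 = y≉0 y≈0

  ^-nonzero : ∀ {x} n → x ≉ 0# → x ^ n ≉ 0#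
  ^-nonzero zero    x≉0 = 1≉0
  ^-nonzero (suc n) x≉0 = *-nonzero x≉0 (^-nonzero n x≉0)

  x*y≈-1⇒x≉0 : ∀ {x y} → x * y ≈ - 1# → x ≉ 0#
  x*y≈-1⇒x≉0 {x} {y} xy≈-1 x≈0 = -1≉0 (trans (sym xy≈-1) (trans (*-congʳ x≈0) (zeroˡ y)))

  ∏-nonzero : ∀ {n} (f : Fin n → Carrier) → (∀ i → f i ≉ 0#) → ∏.sum f ≉ 0#
  ∏-nonzero {zero}  f f≉0 = 1≉0
  ∏-nonzero {suc n} f f≉0 = *-nonzero (f≉0 zero) (∏-nonzero (f ∘ suc) (f≉0 ∘ suc))

  1^n≈1 : ∀ n → 1# ^ n ≈ 1#
  1^n≈1 zero    = refl
  1^n≈1 (suc n) = trans (*-identityˡ _) (1^n≈1 n)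

  -1²≈1 : (- 1#) ^ 2 ≈ 1#
  -1²≈1 = trans (*-congˡ (*-identityʳ (- 1#))) (trans (-1*x≈-x (- 1#)) (⁻¹-involutive 1#))

  x*y≈-1∧y²≈1⇒x²≈1 : ∀ {x y} → x * y ≈ - 1# → y ^ 2 ≈ 1# → x ^ 2 ≈ 1#
  x*y≈-1∧y²≈1⇒x²≈1 {x} {y} xy≈-1 y²≈1 = begin
    x ^ 2          ≈⟨ *-identityʳ (x ^ 2) ⟨
    x ^ 2 * 1#     ≈⟨ *-congˡ y²≈1 ⟨
    x ^ 2 * y ^ 2  ≈⟨ ^-distrib-* x y 2 ⟨
    (x * y) ^ 2    ≈⟨ ^-congˡ 2 xy≈-1 ⟩
    (- 1#) ^ 2     ≈⟨ -1²≈1 ⟩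
    1#             ∎

  factorise : ∀ s g h → (s - g) * (s + h) ≈ s * s - (g - h) * s - g * h
  factorise s g h = begin
    (s - g) * (s + h)                  ≈⟨ distribˡ (s - g) s h ⟩
    (s - g) * s + (s - g) * h          ≈⟨ +-cong ([y-z]x≈yx-zx s s g) ([y-z]x≈yx-zx h s g) ⟩
    (s * s - g * s) + (s * h - g * h)  ≈⟨ +-rearrange (s * s) (- (g * s)) (s * h) (- (g * h)) ⟩
    s * s + (s * h - g * s) - g * h    ≈⟨ +-congʳ (+-congˡ (sym (⁻¹-anti-homo-// (g * s) (s * h)))) ⟩
    s * s - (g * s - s * h) - g * h    ≈⟨ +-congʳ (+-congˡ (-‿cong (+-congˡ (-‿cong (*-comm s h))))) ⟩
    s * s - (g * s - h * s) - g * h    ≈⟨ +-congʳ (+-congˡ (-‿cong (sym ([y-z]x≈yx-zx s g h)))) ⟩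
    s * s - (g - h) * s - g * h        ∎
    where
    open Algebra.Solver.CommutativeMonoid +-commutativeMonoid using (solve; _⊕_; _⊜_)
    +-rearrange : ∀ a b c d → (a + b) + (c + d) ≈ (a + (c + b)) + d
    +-rearrange = solve 4 (λ a b c d → (a ⊕ b) ⊕ (c ⊕ d) ⊜ (a ⊕ (c ⊕ b)) ⊕ d) refl

  x*x≈1⇒x≈±1 : ∀ x → x * x ≈ 1# → x ≈ 1# ⊎ x ≈ - 1#
  x*x≈1⇒x≈±1 x x*x≈1 with x*y≈0⇒x≈0⊎y≈0 (trans (factorise x 1# 1#) x*x-0*x-1≈0)
    where
    x*x-0*x-1≈0 : x * x - (1# - 1#) * x - 1# * 1# ≈ 0#
    x*x-0*x-1≈0 = begin
      x * x - (1# - 1#) * x - 1# * 1#  ≈⟨ +-cong (+-cong x*x≈1 (-‿cong (trans (*-congʳ (-‿inverseʳ 1#)) (zeroˡ x))))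
                                                 (-‿cong (*-identityˡ 1#)) ⟩
      1# - 0# - 1#                     ≈⟨ +-congʳ (trans (+-congˡ ε⁻¹≈ε) (+-identityʳ 1#)) ⟩
      1# - 1#                          ≈⟨ -‿inverseʳ 1# ⟩
      0#                               ∎
  ... | inj₁ x-1≈0 = inj₁ (x∙y⁻¹≈ε⇒x≈y x 1# x-1≈0)
  ... | inj₂ x+1≈0 = inj₂ (inverseˡ-unique x 1# x+1≈0)

  x≉±1⇒x²≉1 : ∀ {x} → x ≉ 1# → x ≉ - 1# → x ^ 2 ≉ 1#
  x≉±1⇒x²≉1 {x} x≉1 x≉-1 x²≈1 with x*x≈1⇒x≈±1 x (trans (*-congˡ (sym (*-identityʳ x))) x²≈1)
  ... | inj₁ x≈1  = x≉1 x≈1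
  ... | inj₂ x≈-1 = x≉-1 x≈-1

  ^-∣ : ∀ {y d n} → d ∣ n → y ^ d ≈ 1# → y ^ n ≈ 1#
  ^-∣ {y} {d} (divides k ≡.refl) yᵈ≈1 = begin
    y ^ (k ℕ.* d) ≡⟨ ≡.cong (y ^_) (ℕ.*-comm k d) ⟩
    y ^ (d ℕ.* k) ≈⟨ sym (^-assocʳ y d k) ⟩
    (y ^ d) ^ k   ≈⟨ ^-congˡ k yᵈ≈1 ⟩
    1# ^ k        ≈⟨ 1^n≈1 k ⟩
    1#            ∎

  ^-% : ∀ {y} m k .{{_ : NonZero m}} → y ^ m ≈ 1# → y ^ k ≈ y ^ (k % m)
  ^-% {y} m k yᵐ≈1 = begin
    y ^ k                                ≡⟨ ≡.cong (y ^_) (m≡m%n+[m/n]*n k m) ⟩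
    y ^ (k % m ℕ.+ (k / m) ℕ.* m)        ≈⟨ ^-homo-* y (k % m) ((k / m) ℕ.* m) ⟩
    y ^ (k % m) * y ^ ((k / m) ℕ.* m)    ≈⟨ *-congˡ (^-∣ (n∣m*n (k / m)) yᵐ≈1) ⟩
    y ^ (k % m) * 1#                     ≈⟨ *-identityʳ _ ⟩
    y ^ (k % m)                          ∎

  ^-+-cancel : ∀ {y} m n → y ^ (m ℕ.+ n) ≈ 1# → y ^ n ≈ 1# → y ^ m ≈ 1#
  ^-+-cancel {y} m n yᵐ⁺ⁿ≈1 yⁿ≈1 = begin
    y ^ m           ≈⟨ sym (*-identityʳ _) ⟩
    y ^ m * 1#      ≈⟨ *-congˡ (sym yⁿ≈1) ⟩
    y ^ m * y ^ n   ≈⟨ sym (^-homo-* y m n) ⟩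
    y ^ (m ℕ.+ n)   ≈⟨ yᵐ⁺ⁿ≈1 ⟩
    1#              ∎

  ^-gcd : ∀ {y m n} → y ^ m ≈ 1# → y ^ n ≈ 1# → y ^ gcd m n ≈ 1#
  ^-gcd {y} {m} {n} yᵐ≈1 yⁿ≈1 with Bézout.identity (gcd-GCD m n)
  ... | Bézout.+- a b d+bn≡am =
    ^-+-cancel (gcd m n) (b ℕ.* n) (trans (^-congʳ y d+bn≡am) (^-∣ (n∣m*n a) yᵐ≈1)) (^-∣ (n∣m*n b) yⁿ≈1)
  ... | Bézout.-+ a b d+am≡bn =
    ^-+-cancel (gcd m n) (a ℕ.* m) (trans (^-congʳ y d+am≡bn) (^-∣ (n∣m*n b) yⁿ≈1)) (^-∣ (n∣m*n a) yᵐ≈1)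

  ^-cancel-≤ : ∀ {y} i j → y ≉ 0# → i ℕ.≤ j → y ^ i ≈ y ^ j → y ^ (j ∸ i) ≈ 1#
  ^-cancel-≤ {y} i j y≉0 i≤j yⁱ≈yʲ = sym (*-cancelˡ (^-nonzero i y≉0) (begin
    y ^ i * 1#              ≈⟨ *-identityʳ _ ⟩
    y ^ i                   ≈⟨ yⁱ≈yʲ ⟩
    y ^ j                   ≡⟨ ≡.cong (y ^_) (ℕ.m+[n∸m]≡n i≤j) ⟨
    y ^ (i ℕ.+ (j ∸ i))     ≈⟨ ^-homo-* y i (j ∸ i) ⟩
    y ^ i * y ^ (j ∸ i)     ∎))

  -1^odd≈-1 : ∀ n → ¬ (2 ∣ n) → (- 1#) ^ n ≈ - 1#
  -1^odd≈-1 n 2∤n = begin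
    (- 1#) ^ n         ≈⟨ ^-% 2 n -1²≈1 ⟩
    (- 1#) ^ (n % 2)   ≡⟨ ≡.cong ((- 1#) ^_) (%2≡1 n 2∤n) ⟩
    - 1# * 1#          ≈⟨ *-identityʳ (- 1#) ⟩
    - 1#               ∎

  module Reindexing {n} (e : Fin n → Carrier) (e-injective : ∀ {i j} → e i ≈ e j → i ≡ j)
                    {φ ψ : Carrier → Carrier}
                    (φ-cong : ∀ {x y} → x ≈ y → φ x ≈ φ y) (ψ-cong : ∀ {x y} → x ≈ y → ψ x ≈ ψ y)
                    (φ∘ψ≈id : ∀ x → φ (ψ x) ≈ x) (ψ∘φ≈id : ∀ x → ψ (φ x) ≈ x)
                    (φ-image : ∀ i → ∃ λ j → φ (e i) ≈ e j) (ψ-image : ∀ i → ∃ λ j → ψ (e i) ≈ e j)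
                    where
    private
      σ τ : Fin n → Fin n
      σ i = proj₁ (φ-image i)
      τ i = proj₁ (ψ-image i)

      σ∘τ≡id : ∀ i → σ (τ i) ≡ i
      σ∘τ≡id i = e-injective (begin
        e (σ (τ i))  ≈⟨ sym (proj₂ (φ-image (τ i))) ⟩
        φ (e (τ i))  ≈⟨ φ-cong (sym (proj₂ (ψ-image i))) ⟩
        φ (ψ (e i))  ≈⟨ φ∘ψ≈id (e i) ⟩
        e i          ∎)

      τ∘σ≡id : ∀ i → τ (σ i) ≡ i
      τ∘σ≡id i = e-injective (begin
        e (τ (σ i))  ≈⟨ sym (proj₂ (ψ-image (σ i))) ⟩
        ψ (e (σ i))  ≈⟨ ψ-cong (sym (proj₂ (φ-image i))) ⟩
        ψ (φ (e i))  ≈⟨ ψ∘φ≈id (e i) ⟩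
        e i          ∎)

    reindex : Permutation′ n
    reindex = permutation σ τ σ∘τ≡id τ∘σ≡id

    reindex-spec : ∀ i → e (reindex ⟨$⟩ʳ i) ≈ φ (e i)
    reindex-spec i = sym (proj₂ (φ-image i))

  size·1≈0 : size · 1# ≈ 0#
  size·1≈0 = ∙-cancelˡ S (size · 1#) 0# (begin
    S + size · 1#                  ≈⟨ +-congˡ (sym (∑.sum-replicate size)) ⟩
    S + ∑.sum {size} (λ _ → 1#)    ≈⟨ sym (∑.∑-distrib-+ enum (λ _ → 1#)) ⟩
    ∑.sum (λ i → enum i + 1#)      ≈⟨ ∑.sum-cong-≋ reindex-spec ⟨
    ∑.sum (enum ∘ (reindex ⟨$⟩ʳ_)) ≈⟨ ∑.sum-permute enum reindex ⟨
    S                              ≈⟨ +-identityʳ S ⟨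
    S + 0#                         ∎)
    where
    S : Carrier
    S = ∑.sum enum
    open Reindexing enum (enum-inj _ _) +-congʳ +-congʳ
      (λ x → trans (+-assoc x (- 1#) 1#) (trans (+-congˡ (-‿inverseˡ 1#)) (+-identityʳ x)))
      (λ x → trans (+-assoc x 1# (- 1#)) (trans (+-congˡ (-‿inverseʳ 1#)) (+-identityʳ x)))
      (λ i → enum-surj (enum i + 1#)) (λ i → enum-surj (enum i - 1#))

  -1≉1 : ∀ {k} → size ≡ 2 ℕ.* k ℕ.+ 1 → - 1# ≉ 1#
  -1≉1 {k} size≡2k+1 -1≈1 = 0≉1 (begin
    0#                      ≈⟨ size·1≈0 ⟨
    size · 1#               ≡⟨ ≡.cong (_· 1#) (≡.trans size≡2k+1 (ℕ.+-comm (2 ℕ.* k) 1)) ⟩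
    1# + (2 ℕ.* k) · 1#     ≡⟨ ≡.cong (λ m → 1# + m · 1#) (ℕ.*-comm 2 k) ⟩
    1# + (k ℕ.* 2) · 1#     ≈⟨ +-congˡ (×-assocˡ 1# k 2) ⟨
    1# + k · (2 · 1#)       ≈⟨ +-congˡ (×-congʳ k 2·1≈0) ⟩
    1# + k · 0#             ≈⟨ +-congˡ (trans (sym (∑.sum-replicate k)) (∑.sum-replicate-zero k)) ⟩
    1# + 0#                 ≈⟨ +-identityʳ 1# ⟩
    1#                      ∎)
    where
    2·1≈0 : 2 · 1# ≈ 0#
    2·1≈0 = trans (+-congˡ (trans (+-identityʳ 1#) (sym -1≈1))) (-‿inverseʳ 1#)

  powers-distinct : ∀ {y n i j} → y ≉ 0# → (∀ k → 0 ℕ.< k → k ℕ.< n → y ^ k ≉ 1#) →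
                    i ℕ.< n → j ℕ.< n → y ^ i ≈ y ^ j → i ≡ j
  powers-distinct {y} {n} {i} {j} y≉0 no-smaller-order i<n j<n yⁱ≈yʲ with ℕ.<-cmp i j
  ... | tri≈ _ i≡j _ = i≡j
  ... | tri< i<j _ _ = contradiction (^-cancel-≤ i j y≉0 (ℕ.<⇒≤ i<j) yⁱ≈yʲ)
    (no-smaller-order (j ∸ i) (ℕ.m<n⇒0<n∸m i<j) (ℕ.≤-<-trans (ℕ.m∸n≤m j i) j<n))
  ... | tri> _ _ j<i = contradiction (^-cancel-≤ j i y≉0 (ℕ.<⇒≤ j<i) (sym yⁱ≈yʲ))
    (no-smaller-order (i ∸ j) (ℕ.m<n⇒0<n∸m j<i) (ℕ.≤-<-trans (ℕ.m∸n≤m i j) i<n))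

  -- Matching on the equation retypes enum over Fin k, so no transport along size ≡ k is needed.
  reenumerate : ∀ {k} → size ≡ k →
                ∃ λ (e : Fin k → Carrier) → (∀ {i j} → e i ≈ e j → i ≡ j) × (∀ x → ∃ λ i → x ≈ e i)
  reenumerate ≡.refl = enum , enum-inj _ _ , enum-surj

  module Units {M} (size≡1+M : size ≡ suc M) where
    private
      element : Fin (suc M) → Carrier
      element = proj₁ (reenumerate size≡1+M)

      element-injective : ∀ {i j} → element i ≈ element j → i ≡ j
      element-injective = proj₁ (proj₂ (reenumerate size≡1+M))

      element-surjective : ∀ x → ∃ λ i → x ≈ element i
      element-surjective = proj₂ (proj₂ (reenumerate size≡1+M))

      zeroIndex : Fin (suc M)
      zeroIndex = proj₁ (element-surjective 0#)

      zero≈element-zeroIndex : 0# ≈ element zeroIndex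
      zero≈element-zeroIndex = proj₂ (element-surjective 0#)

    unit : Fin M → Carrier
    unit i = element (punchIn zeroIndex i)

    unit-nonzero : ∀ i → unit i ≉ 0#
    unit-nonzero i unitᵢ≈0 =
      Fin.punchInᵢ≢i zeroIndex i (element-injective (trans unitᵢ≈0 zero≈element-zeroIndex))

    unit-injective : ∀ {i j} → unit i ≈ unit j → i ≡ j
    unit-injective = Fin.punchIn-injective zeroIndex _ _ ∘ element-injective

    unit-surjective : ∀ x → x ≉ 0# → ∃ λ i → x ≈ unit i
    unit-surjective x x≉0 with element-surjective x
    ... | j , x≈eⱼ = punchOut zeroIndex≢j ,
      trans x≈eⱼ (reflexive (≡.cong element (≡.sym (Fin.punchIn-punchOut zeroIndex≢j))))
      where
      zeroIndex≢j : zeroIndex ≢ j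
      zeroIndex≢j ≡.refl = x≉0 (trans x≈eⱼ (sym zero≈element-zeroIndex))

    nonzero-injective⇒≤ : ∀ {m} (h : Fin m → Carrier) → (∀ i → h i ≉ 0#) →
                          (∀ {i j} → h i ≈ h j → i ≡ j) → m ℕ.≤ M
    nonzero-injective⇒≤ {m} h h≉0 h-injective =
      Fin.injective⇒≤ {f = index} λ {i} {j} indexᵢ≡indexⱼ → h-injective (begin
      h i            ≈⟨ proj₂ (unit-surjective (h i) (h≉0 i)) ⟩
      unit (index i) ≡⟨ ≡.cong unit indexᵢ≡indexⱼ ⟩
      unit (index j) ≈⟨ proj₂ (unit-surjective (h j) (h≉0 j)) ⟨
      h j            ∎)
      where
      index : Fin m → Fin M
      index i = proj₁ (unit-surjective (h i) (h≉0 i))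

    covers-nonzero⇒≥ : ∀ {m} (h : Fin m → Carrier) → (∀ x → x ≉ 0# → ∃ λ i → x ≈ h i) → M ℕ.≤ m
    covers-nonzero⇒≥ {m} h covers =
      Fin.injective⇒≤ {f = index} λ {i} {j} indexᵢ≡indexⱼ → unit-injective (begin
      unit i      ≈⟨ proj₂ (covers (unit i) (unit-nonzero i)) ⟩
      h (index i) ≡⟨ ≡.cong h indexᵢ≡indexⱼ ⟩
      h (index j) ≈⟨ proj₂ (covers (unit j) (unit-nonzero j)) ⟨
      unit j      ∎)
      where
      index : Fin M → Fin m
      index i = proj₁ (covers (unit i) (unit-nonzero i))

    fermat : ∀ {x} → x ≉ 0# → x ^ M ≈ 1#
    fermat {x} x≉0 = sym (*-cancelˡ (∏-nonzero unit unit-nonzero) (begin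
      P * 1#                          ≈⟨ *-identityʳ P ⟩
      P                               ≈⟨ ∏.sum-permute unit reindex ⟩
      ∏.sum (unit ∘ (reindex ⟨$⟩ʳ_))  ≈⟨ ∏.sum-cong-≋ reindex-spec ⟩
      ∏.sum (λ i → x * unit i)        ≈⟨ ∏.∑-distrib-+ (λ _ → x) unit ⟩
      ∏.sum {M} (λ _ → x) * P         ≈⟨ *-congʳ (∏.sum-replicate M) ⟩
      x ^ M * P                       ≈⟨ *-comm (x ^ M) P ⟩
      P * x ^ M                       ∎))
      where
      P : Carrier
      P = ∏.sum unit
      x⁻¹ : Carrier
      x⁻¹ = proj₁ (inverse x x≉0)
      xx⁻¹≈1 : x * x⁻¹ ≈ 1#
      xx⁻¹≈1 = proj₂ (inverse x x≉0)
      x⁻¹≉0 : x⁻¹ ≉ 0#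
      x⁻¹≉0 x⁻¹≈0 = 1≉0 (trans (sym xx⁻¹≈1) (trans (*-congˡ x⁻¹≈0) (zeroʳ x)))
      open Reindexing unit unit-injective *-congˡ *-congˡ
        (λ y → trans (sym (*-assoc x x⁻¹ y)) (trans (*-congʳ xx⁻¹≈1) (*-identityˡ y)))
        (λ y → trans (sym (*-assoc x⁻¹ x y)) (trans (*-congʳ (trans (*-comm x⁻¹ x) xx⁻¹≈1)) (*-identityˡ y)))
        (λ i → unit-surjective (x * unit i) (*-nonzero x≉0 (unit-nonzero i)))
        (λ i → unit-surjective (x⁻¹ * unit i) (*-nonzero x⁻¹≉0 (unit-nonzero i)))

    generator⇒primitive : ∀ {y} → y ≉ 0# → (∀ k → 0 ℕ.< k → k ℕ.< M → y ^ k ≉ 1#) → IsPrimitiveRoot F y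
    generator⇒primitive {y} y≉0 no-smaller-order = y≉0 , power-of
      where
      -- Otherwise x, y⁰, …, y^(M−1) would be M + 1 distinct units.
      power-of : ∀ x → x ≉ 0# → ∃ λ k → x ≈ y ^ k
      power-of x x≉0 with Fin.any? (λ (i : Fin M) → x ≟ (y ^ toℕ i))
      ... | yes (i , x≈yⁱ) = toℕ i , x≈yⁱ
      ... | no  x∉powers  = contradiction (nonzero-injective⇒≤ h h-nonzero h-injective) ℕ.1+n≰n
        where
        h : Fin (suc M) → Carrier
        h zero    = x
        h (suc i) = y ^ toℕ i
        h-nonzero : ∀ i → h i ≉ 0#
        h-nonzero zero    = x≉0
        h-nonzero (suc i) = ^-nonzero (toℕ i) y≉0
        h-injective : ∀ {i j} → h i ≈ h j → i ≡ j
        h-injective {zero}  {zero}  _     = ≡.refl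
        h-injective {zero}  {suc j} x≈yʲ  = contradiction (j , x≈yʲ) x∉powers
        h-injective {suc i} {zero}  yⁱ≈x  = contradiction (i , sym yⁱ≈x) x∉powers
        h-injective {suc i} {suc j} yⁱ≈yʲ = ≡.cong suc (Fin.toℕ-injective
          (powers-distinct y≉0 no-smaller-order (Fin.toℕ<n i) (Fin.toℕ<n j) yⁱ≈yʲ))

    primitive⇒order≥ : ∀ {g m} → IsPrimitiveRoot F g → 0 ℕ.< m → g ^ m ≈ 1# → M ℕ.≤ m
    primitive⇒order≥ {g} {m} (_ , generates) 0<m gᵐ≈1 =
      covers-nonzero⇒≥ (λ (i : Fin m) → g ^ toℕ i) covered
      where
      instance m≢0 : NonZero m
               m≢0 = ℕ.>-nonZero 0<m
      covered : ∀ x → x ≉ 0# → ∃ λ i → x ≈ g ^ toℕ i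
      covered x x≉0 with generates x x≉0
      ... | k , x≈gᵏ = fromℕ< (m%n<n k m) , (begin
        x                                 ≈⟨ x≈gᵏ ⟩
        g ^ k                             ≈⟨ ^-% m k gᵐ≈1 ⟩
        g ^ (k % m)                       ≡⟨ ≡.cong (g ^_) (Fin.toℕ-fromℕ< (m%n<n k m)) ⟨
        g ^ toℕ (fromℕ< (m%n<n k m))      ∎)

  order-2p : ∀ {p y} → Prime p → y ^ (2 ℕ.* p) ≈ 1# → y ^ 2 ≉ 1# → y ^ p ≉ 1# →
             ∀ k → 0 ℕ.< k → k ℕ.< 2 ℕ.* p → y ^ k ≉ 1#
  order-2p {p} {y} p-prime y²ᵖ≈1 y²≉1 yᵖ≉1 k 0<k k<2p yᵏ≈1
    with ∣2*p⇒∣2⊎≡p p-prime (gcd[m,n]∣n k (2 ℕ.* p)) gcd<2p | ^-gcd {y} {k} {2 ℕ.* p} yᵏ≈1 y²ᵖ≈1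
    where
    instance k≢0 : NonZero k
             k≢0 = ℕ.>-nonZero 0<k
    gcd<2p : gcd k (2 ℕ.* p) ℕ.< 2 ℕ.* p
    gcd<2p = ℕ.≤-<-trans (∣⇒≤ (gcd[m,n]∣m k (2 ℕ.* p))) k<2p
  ... | inj₁ gcd∣2 | yᵍᶜᵈ≈1 = y²≉1 (^-∣ gcd∣2 yᵍᶜᵈ≈1)
  ... | inj₂ gcd≡p | yᵍᶜᵈ≈1 = yᵖ≉1 (trans (^-congʳ y (≡.sym gcd≡p)) yᵍᶜᵈ≈1)

  module LucasRoots {γ γ⁻¹} (γγ⁻¹≈1 : γ * γ⁻¹ ≈ 1#) where
    lucas-factorisation : ∀ s → s * s - (γ - γ⁻¹) * s - 1# ≈ (s - γ) * (s + γ⁻¹)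
    lucas-factorisation s = trans (+-congˡ (-‿cong (sym γγ⁻¹≈1))) (sym (factorise s γ γ⁻¹))

    γ-root : IsRootOfLucasPoly F (γ - γ⁻¹) γ
    γ-root = trans (lucas-factorisation γ) (trans (*-congʳ (-‿inverseʳ γ)) (zeroˡ _))

    -γ⁻¹-root : IsRootOfLucasPoly F (γ - γ⁻¹) (- γ⁻¹)
    -γ⁻¹-root = trans (lucas-factorisation (- γ⁻¹)) (trans (*-congˡ (-‿inverseˡ γ⁻¹)) (zeroʳ _))

    root⇒≈γ⊎≈-γ⁻¹ : ∀ s → IsRootOfLucasPoly F (γ - γ⁻¹) s → s ≈ γ ⊎ s ≈ - γ⁻¹
    root⇒≈γ⊎≈-γ⁻¹ s s-root with x*y≈0⇒x≈0⊎y≈0 (trans (sym (lucas-factorisation s)) s-root)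
    ... | inj₁ s-γ≈0   = inj₁ (x∙y⁻¹≈ε⇒x≈y s γ s-γ≈0)
    ... | inj₂ s+γ⁻¹≈0 = inj₂ (inverseˡ-unique s γ⁻¹ s+γ⁻¹≈0)

    γ*-γ⁻¹≈-1 : γ * - γ⁻¹ ≈ - 1#
    γ*-γ⁻¹≈-1 = trans (sym (-‿distribʳ-* γ γ⁻¹)) (-‿cong γγ⁻¹≈1)

  module OrderTwiceOddPrime {p} (p-prime : Prime p) (p-odd : ¬ (2 ∣ p))
                            (size≡2p+1 : size ≡ 2 ℕ.* p ℕ.+ 1) where
    open Units (≡.trans size≡2p+1 (ℕ.+-comm (2 ℕ.* p) 1))

    private
      0<p : 0 ℕ.< p
      0<p = ℕ.>-nonZero⁻¹ p {{prime⇒nonZero p-prime}}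

      p<2p : p ℕ.< 2 ℕ.* p
      p<2p = ℕ.m<m+n p (ℕ.≤-trans 0<p (ℕ.m≤m+n p 0))

    ^p≈±1 : ∀ {y} → y ≉ 0# → y ^ p ≈ 1# ⊎ y ^ p ≈ - 1#
    ^p≈±1 {y} y≉0 = x*x≈1⇒x≈±1 (y ^ p) (begin
      y ^ p * y ^ p        ≈⟨ ^-homo-* y p p ⟨
      y ^ (p ℕ.+ p)        ≡⟨ ≡.cong (λ n → y ^ (p ℕ.+ n)) (ℕ.+-identityʳ p) ⟨
      y ^ (2 ℕ.* p)        ≈⟨ fermat y≉0 ⟩
      1#                   ∎)

    ^p≈-1⇒primitive : ∀ {y} → y ≉ 0# → y ^ 2 ≉ 1# → y ^ p ≈ - 1# → IsPrimitiveRoot F y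
    ^p≈-1⇒primitive y≉0 y²≉1 yᵖ≈-1 = generator⇒primitive y≉0
      (order-2p p-prime (fermat y≉0) y²≉1 λ yᵖ≈1 → -1≉1 {p} size≡2p+1 (trans (sym yᵖ≈-1) yᵖ≈1))

    ^p≈1⇒¬primitive : ∀ {y} → y ^ p ≈ 1# → ¬ IsPrimitiveRoot F y
    ^p≈1⇒¬primitive yᵖ≈1 y-primitive = ℕ.<⇒≱ p<2p (primitive⇒order≥ y-primitive 0<p yᵖ≈1)

    x*y≈-1⇒xᵖ*yᵖ≈-1 : ∀ {x y} → x * y ≈ - 1# → x ^ p * y ^ p ≈ - 1#
    x*y≈-1⇒xᵖ*yᵖ≈-1 {x} {y} xy≈-1 = begin
      x ^ p * y ^ p  ≈⟨ ^-distrib-* x y p ⟨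
      (x * y) ^ p    ≈⟨ ^-congˡ p xy≈-1 ⟩
      (- 1#) ^ p     ≈⟨ -1^odd≈-1 p p-odd ⟩
      - 1#           ∎

    ^p≈-1⇒unique-lucas-primitive-root :
      ∀ {a r s} → IsRootOfLucasPoly F a r → (∀ t → IsRootOfLucasPoly F a t → t ≈ r ⊎ t ≈ s) →
      r * s ≈ - 1# → r ^ 2 ≉ 1# → r ^ p ≈ - 1# → HasExactlyOneLucasPrimitiveRoot F a
    ^p≈-1⇒unique-lucas-primitive-root {a} {r} {s} r-root roots rs≈-1 r²≉1 rᵖ≈-1 =
      r , (r-root , ^p≈-1⇒primitive (x*y≈-1⇒x≉0 rs≈-1) r²≉1 rᵖ≈-1) , only-r
      where
      sᵖ≈1 : s ^ p ≈ 1#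
      sᵖ≈1 = ⁻¹-injective (begin
        - (s ^ p)       ≈⟨ -1*x≈-x (s ^ p) ⟨
        - 1# * s ^ p    ≈⟨ *-congʳ rᵖ≈-1 ⟨
        r ^ p * s ^ p   ≈⟨ x*y≈-1⇒xᵖ*yᵖ≈-1 rs≈-1 ⟩
        - 1#            ∎)
      only-r : ∀ t → IsLucasPrimitiveRoot F a t → t ≈ r
      only-r t (t-root , t-primitive) with roots t t-root
      ... | inj₁ t≈r = t≈r
      ... | inj₂ t≈s = contradiction t-primitive (^p≈1⇒¬primitive (trans (^-congˡ p t≈s) sᵖ≈1))

    unique-lucas-primitive-root :
      ∀ {a r s} → IsRootOfLucasPoly F a r → IsRootOfLucasPoly F a s →
      (∀ t → IsRootOfLucasPoly F a t → t ≈ r ⊎ t ≈ s) →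
      r * s ≈ - 1# → r ^ 2 ≉ 1# → HasExactlyOneLucasPrimitiveRoot F a
    unique-lucas-primitive-root {r = r} {s} r-root s-root roots rs≈-1 r²≉1 with ^p≈±1 (x*y≈-1⇒x≉0 rs≈-1)
    ... | inj₂ rᵖ≈-1 = ^p≈-1⇒unique-lucas-primitive-root r-root roots rs≈-1 r²≉1 rᵖ≈-1
    ... | inj₁ rᵖ≈1  = ^p≈-1⇒unique-lucas-primitive-root s-root (λ t → swap ∘ roots t)
      (trans (*-comm s r) rs≈-1)
      (r²≉1 ∘ x*y≈-1∧y²≈1⇒x²≈1 rs≈-1)
      (trans (sym (*-identityˡ (s ^ p))) (trans (*-congʳ (sym rᵖ≈1)) (x*y≈-1⇒xᵖ*yᵖ≈-1 rs≈-1)))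

mainTheorem17 : {c ℓ : Level} (F : FiniteField c ℓ) (p : ℕ) → Prime p → ¬ (2 ∣ p)
    → FiniteField.size F ≡ 2 ℕ.* p ℕ.+ 1
    → (γ γinv : FiniteField.Carrier F)
    → ¬ (FiniteField._≈_ F γ (FiniteField.0# F))
    → FiniteField._≈_ F (FiniteField._*_ F γ γinv) (FiniteField.1# F)
    → ¬ (FiniteField._≈_ F γ (FiniteField.1# F))
    → ¬ (FiniteField._≈_ F γ (FiniteField.-_ F (FiniteField.1# F)))
    → HasExactlyOneLucasPrimitiveRoot F (FiniteField._-_ F γ γinv)
-- The hypothesis γ ≉ 0 is implied by γ * γinv ≈ 1.
mainTheorem17 F p p-prime p-odd size≡2p+1 γ γ⁻¹ _ γγ⁻¹≈1 γ≉1 γ≉-1 =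
  unique-lucas-primitive-root γ-root -γ⁻¹-root root⇒≈γ⊎≈-γ⁻¹ γ*-γ⁻¹≈-1 (x≉±1⇒x²≉1 γ≉1 γ≉-1)
  where
  open FieldProperties F
  open LucasRoots γγ⁻¹≈1
  open OrderTwiceOddPrime p-prime p-odd size≡2p+1
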